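{- For all integers $k,\ell\geq 1$, $\alpha(k,\ell)=(k-1)(\ell-1)+2$.
   Context: A cyclic permutation of a finite set of distinct integers is an arrangement of its elements in a circle, written $(j_1,j_2,\ldots,j_n)$, where two such expressions denote the same cyclic permutation if one is a cyclic rotation of the other; its length is $n$. A cyclic sub-permutation of a cyclic permutation $\sigma$ is obtained by deleting some elements from $\sigma$ and keeping the remaining ones in their cyclic order. A cyclic permutation is increasing if it can be written as $(j_1,\ldots,j_n)$ with $j_1<j_2<\cdots<j_n$, and decreasing if it can be written as $(j_1,\ldots,j_n)$ with $j_1>j_2>\cdots>j_n$. For positive integers $k,\ell$, $\alpha(k,\ell)$ denotes the smallest positive integer $n$ such that every cyclic permutation of $\{1,\ldots,n\}$ has an increasing cyclic sub-permutation of length $k+1$ or a decreasing cyclic sub-permutation of length $\ell+1$. -}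

module Defs where

open import Data.Nat using (ℕ; zero; suc; _<_; _≤_)
open import Data.List using (List; length; drop; take; _++_; applyUpTo)
open import Data.List.Relation.Unary.Linked using (Linked)
open import Data.List.Relation.Binary.Sublist.Propositional using (_⊆_)
open import Data.List.Relation.Binary.Permutation.Propositional using (_↭_)
open import Data.Product using (∃; _×_; Σ)
open import Data.Sum using (_⊎_)
open import Relation.Nullary using (¬_)
open import Relation.Binary.PropositionalEquality using (_≡_)
open import Data.Nat using (_>_)

-- A cyclic permutation is represented by any linear list reading it off
-- the circle; two lists denote the same cyclic permutation iff one is a
-- rotation of the other.
IsRotation : List ℕ → List ℕ → Set
IsRotation xs ys = ∃ λ i → ys ≡ drop i xs ++ take i xs

CycIncreasing : List ℕ → Set
CycIncreasing xs = ∃ λ ys → IsRotation xs ys × Linked _<_ ys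

CycDecreasing : List ℕ → Set
CycDecreasing xs = ∃ λ ys → IsRotation xs ys × Linked _>_ ys

range : ℕ → List ℕ
range n = applyUpTo suc n

-- A cyclic sub-permutation of the cyclic permutation represented by σ
-- is the cyclic permutation represented by a (linear) sublist of σ.
AlphaProperty : ℕ → ℕ → ℕ → Set
AlphaProperty k ℓ n =
  (σ : List ℕ) → σ ↭ range n →
    (∃ λ s → s ⊆ σ × length s ≡ suc k × CycIncreasing s)
    ⊎ (∃ λ s → s ⊆ σ × length s ≡ suc ℓ × CycDecreasing s)

IsAlpha : ℕ → ℕ → ℕ → Set
IsAlpha k ℓ n =
  1 ≤ n × AlphaProperty k ℓ n × (∀ m → 1 ≤ m → m < n → ¬ AlphaProperty k ℓ m)

-- α(k, ℓ) = (k − 1)(ℓ − 1) + 2.  Write k = a + 1 and ℓ = b + 1.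
--
-- Upper bound: every arrangement of 1, …, ab + 2 has the property.  Rotate it so that 1
-- comes first.  By the Erdős–Szekeres theorem (proved here by peeling off greedy increasing
-- runs) the other ab + 1 entries contain an increasing chain of length a + 1 or a decreasing
-- chain of length b + 1; as 1 is the minimum, putting it in front of the former or behind the
-- latter gives the required cyclic chain.
--
-- Lower bound: no m ≤ ab + 1 has the property.  List 1 followed by the cells of an a × b
-- grid, column by column, with values chosen so that along the listing a rise in value
-- strictly raises the row and a fall strictly raises the column.  A linear increasing
-- (decreasing) chain of cells then has at most a (b) entries, and a cyclic one, which is two
-- such runs joined by a weak step, at most a + 1 (b + 1).  A cyclic chain through the minimum
-- 1 must start (end) at 1, so it too has at most 1 + a (1 + b) entries.  Keeping the entries
-- at most m gives an arrangement of 1, …, m with the same avoidance.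

module Submission where

open import Data.Nat using (ℕ; zero; suc; _+_; _*_; _∸_; _≤_; _<_; _>_; z≤n; s≤s; _<?_; _≤?_)
open import Data.Nat.Properties
open import Data.Product using (∃; ∃₂; _×_; _,_; proj₁)
open import Data.Sum using (_⊎_; inj₁; inj₂)
open import Data.Empty using (⊥)
open import Relation.Nullary using (¬_; yes; no; contradiction)
open import Relation.Binary.PropositionalEquality using (_≡_; _≢_; refl; sym; trans; cong; cong₂; subst; subst₂; setoid; module ≡-Reasoning)
open import Data.Fin using (Fin; toℕ; combine; opposite; fromℕ<)
open import Data.Fin.Properties using (toℕ<n; toℕ-combine; combine-monoˡ-<; combine-injective; combine-surjective; toℕ-injective; opposite-prop; opposite-involutive; toℕ-fromℕ<)
open import Data.List using (List; []; _∷_; [_]; length; _++_; take; drop; map; concat; tabulate; filter)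
open import Data.List.Properties using (length-applyUpTo; length-map; ++-identityʳ; ++-assoc; length-++; length-++-sucʳ; length-++-comm; length-take; take++drop≡id; take-map; drop-map; map-++)
open import Data.List.Membership.Propositional using (_∈_)
open import Data.List.Relation.Unary.Any using (here; there)
open import Data.List.Relation.Unary.All as All using (All; []; _∷_)
import Data.List.Relation.Unary.All.Properties as Allₚ
open import Data.List.Relation.Unary.AllPairs as AllPairs using (AllPairs; []; _∷_)
import Data.List.Relation.Unary.AllPairs.Properties as AllPairsₚ
open import Data.List.Relation.Unary.Linked as Linked using (Linked; []; [-]; _∷_)
import Data.List.Relation.Unary.Linked.Properties as Linkedₚ
open import Data.List.Relation.Unary.Unique.Propositional using (Unique)
import Data.List.Relation.Unary.Unique.Propositional.Properties as Uniqueₚ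
open import Data.List.Relation.Binary.Permutation.Propositional using (_↭_; prep; ↭-sym; ↭-trans; ↭⇒↭ₛ)
open import Data.List.Relation.Binary.Permutation.Propositional.Properties using (shift; ++-comm; ↭-length; ∈-resp-↭)
import Data.List.Relation.Binary.Permutation.Setoid.Properties as Permₛ
open import Data.List.Membership.Propositional.Properties using (∈-∃++; ∈-applyUpTo⁺; ∈-applyUpTo⁻; ∈-map⁺; ∈-map⁻; ∈-filter⁺; ∈-filter⁻; ∈-concat⁺′; ∈-tabulate⁺)
open import Data.List.Membership.Propositional.Properties.WithK using (unique∧set⇒bag)
open import Data.List.Relation.Binary.BagAndSetEquality using (∼bag⇒↭)
open import Function.Bundles using (mk⇔)
open import Relation.Binary.Definitions using (tri<; tri≈; tri>)
open import Data.List.Relation.Binary.Sublist.Propositional using (_⊆_; []; _∷_; _∷ʳ_; ⊆-trans)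
import Data.List.Relation.Binary.Sublist.Propositional.Properties as Sublistₚ

open import Defs

private
  variable
    A B : Set
    R : A → A → Set
    x : A
    xs ys : List A

allPairs-++⁻ : ∀ (xs : List A) {ys} → AllPairs R (xs ++ ys) →
  AllPairs R xs × AllPairs R ys × (∀ {x y} → x ∈ xs → y ∈ ys → R x y)
allPairs-++⁻ [] rs = [] , rs , λ ()
allPairs-++⁻ (x ∷ xs) (r ∷ rs) with allPairs-++⁻ xs rs
... | inside , outside , across =
  Allₚ.++⁻ˡ xs r ∷ inside , outside ,
  λ { (here refl) y∈ys → All.lookup (Allₚ.++⁻ʳ xs r) y∈ys ; (there x∈xs) y∈ys → across x∈xs y∈ys }

allPairs-⊆ : xs ⊆ ys → AllPairs R ys → AllPairs R xs
allPairs-⊆ [] rs = rs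
allPairs-⊆ (_ ∷ʳ sub) (_ ∷ rs) = allPairs-⊆ sub rs
allPairs-⊆ (refl ∷ sub) (r ∷ rs) = Sublistₚ.All-resp-⊆ sub r ∷ allPairs-⊆ sub rs

sublist-map⁻ : ∀ (f : A → B) (xs : List A) {s} → s ⊆ map f xs → ∃ λ ps → ps ⊆ xs × s ≡ map f ps
sublist-map⁻ f [] [] = [] , [] , refl
sublist-map⁻ f (x ∷ xs) (_ ∷ʳ sub) with sublist-map⁻ f xs sub
... | ps , ps⊆ , refl = ps , x ∷ʳ ps⊆ , refl
sublist-map⁻ f (x ∷ xs) (refl ∷ sub) with sublist-map⁻ f xs sub
... | ps , ps⊆ , refl = x ∷ ps , refl ∷ ps⊆ , refl

sublist-++⁻ : ∀ (ys zs : List A) {s} → s ⊆ ys ++ zs → ∃₂ λ s₁ s₂ → s₁ ⊆ ys × s₂ ⊆ zs × s ≡ s₁ ++ s₂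
sublist-++⁻ [] zs sub = [] , _ , [] , sub , refl
sublist-++⁻ (y ∷ ys) zs (_ ∷ʳ sub) with sublist-++⁻ ys zs sub
... | s₁ , s₂ , sub₁ , sub₂ , refl = s₁ , s₂ , y ∷ʳ sub₁ , sub₂ , refl
sublist-++⁻ (y ∷ ys) zs (refl ∷ sub) with sublist-++⁻ ys zs sub
... | s₁ , s₂ , sub₁ , sub₂ , refl = y ∷ s₁ , s₂ , refl ∷ sub₁ , sub₂ , refl

linked-cons : All (R x) xs → Linked R xs → Linked R (x ∷ xs)
linked-cons [] [] = [-]
linked-cons (r ∷ _) l = r ∷ l

linked-snoc : All (λ y → R y x) xs → Linked R xs → Linked R (xs ++ [ x ])
linked-snoc [] [] = [-]
linked-snoc (r ∷ []) [-] = r ∷ [-]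
linked-snoc (_ ∷ rs) (l ∷ ls) = l ∷ linked-snoc rs ls

>-trans : ∀ {l m n : ℕ} → l > m → m > n → l > n
>-trans l>m m>n = <-trans m>n l>m

CycLinked : (ℕ → ℕ → Set) → List ℕ → Set
CycLinked R xs = ∃ λ ys → IsRotation xs ys × Linked R ys

Chain CycChain : (ℕ → ℕ → Set) → ℕ → List ℕ → Set
Chain R n xs = ∃ λ s → s ⊆ xs × length s ≡ n × Linked R s
CycChain R n xs = ∃ λ s → s ⊆ xs × length s ≡ n × CycLinked R s

swap-is-rotation : ∀ (u v : List ℕ) → IsRotation (u ++ v) (v ++ u)
swap-is-rotation u v = length u , cong₂ _++_ (sym (drop-prefix u)) (sym (take-prefix u))
  where
  drop-prefix : ∀ u → drop (length u) (u ++ v) ≡ v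
  drop-prefix [] = refl
  drop-prefix (_ ∷ u) = drop-prefix u
  take-prefix : ∀ u → take (length u) (u ++ v) ≡ u
  take-prefix [] = refl
  take-prefix (y ∷ u) = cong (y ∷_) (take-prefix u)

rotation-∷ : ∀ {x : ℕ} {t ys} → IsRotation (x ∷ t) ys → ∃₂ λ v w → t ≡ w ++ v × ys ≡ v ++ x ∷ w
rotation-∷ {x} {t} (zero , refl) = [] , t , sym (++-identityʳ t) , cong (x ∷_) (++-identityʳ t)
rotation-∷ {x} {t} (suc i , refl) = drop i t , take i t , sym (take++drop≡id i t) , refl

rotation-map : ∀ (f : A → ℕ) (ps : List A) {ys} → IsRotation (map f ps) ys →
  ∃₂ λ pu pv → ps ≡ pu ++ pv × ys ≡ map f (pv ++ pu)
rotation-map f ps (i , refl) =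
  take i ps , drop i ps , sym (take++drop≡id i ps) ,
  trans (cong₂ _++_ (drop-map i ps) (take-map i ps)) (sym (map-++ f (drop i ps) (take i ps)))

min-first-increasing : ∀ {x : ℕ} {t} → All (x <_) t → CycLinked _<_ (x ∷ t) → Linked _<_ t
min-first-increasing x<t (ys , rot , lin) with rotation-∷ rot
... | [] , w , refl , refl = subst (Linked _<_) (sym (++-identityʳ w)) (Linked.tail lin)
... | y ∷ v , w , refl , refl
  with allPairs-++⁻ (y ∷ v) (Linkedₚ.Linked⇒AllPairs <-trans lin)
...   | _ , _ , across = contradiction (across (here refl) (here refl))
                           (<⇒≯ (All.lookup (Allₚ.++⁻ʳ w x<t) (here refl)))

min-last-decreasing : ∀ {x : ℕ} {t} → All (x <_) t → CycLinked _>_ (x ∷ t) → Linked _>_ t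
min-last-decreasing x<t (ys , rot , lin) with rotation-∷ rot
... | v , w , refl , refl with allPairs-++⁻ v (Linkedₚ.Linked⇒AllPairs >-trans lin)
... | before , after , _ with w
...   | [] = Linkedₚ.AllPairs⇒Linked before
...   | z ∷ _ = contradiction (All.head (AllPairs.head after)) (<⇒≯ (All.head x<t))

prefix-chain : ∀ n {ys xs : List ℕ} → ys ⊆ xs → Linked _<_ ys → n ≤ length ys → Chain _<_ n xs
prefix-chain n {ys} ys⊆xs lin n≤ =
  take n ys , ⊆-trans (Sublistₚ.take-⊆ n ys) ys⊆xs ,
  trans (length-take n ys) (m≤n⇒m⊓n≡m n≤) ,
  Linkedₚ.AllPairs⇒Linked (AllPairsₚ.take⁺ n (Linkedₚ.Linked⇒AllPairs <-trans lin))

-- Greedy decomposition of the entries following m (all entries distinct): run is the greedy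
-- increasing run starting at m, and every entry of rest has a larger entry before it, so a
-- decreasing chain in rest extends by one entry at its front.
record Peel (m : ℕ) (xs : List ℕ) : Set where
  field
    run rest : List ℕ
    run⊆ : run ⊆ xs
    rest⊆ : rest ⊆ xs
    run-increasing : Linked _<_ (m ∷ run)
    sizes : length run + length rest ≡ length xs
    extend : ∀ {h t} → h ∷ t ⊆ rest → ∃ λ w → w ∷ h ∷ t ⊆ m ∷ xs × h < w

-- By recursion on xs: an entry above m joins the run (which continues from it), an entry
-- below m goes to rest, with m itself as its larger predecessor.
peel : ∀ m xs → Unique (m ∷ xs) → Peel m xs
peel m [] _ = record
  { run = [] ; rest = [] ; run⊆ = [] ; rest⊆ = [] ; run-increasing = [-] ; sizes = refl ; extend = λ () }
peel m (y ∷ ys) ((m≢y ∷ m∉ys) ∷ distinct) with m <? y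
... | yes m<y = record
  { run = y ∷ run ; rest = rest ; run⊆ = refl ∷ run⊆ ; rest⊆ = y ∷ʳ rest⊆
  ; run-increasing = m<y ∷ run-increasing ; sizes = cong suc sizes
  ; extend = λ sub → let (w , w∷sub , h<w) = extend sub in w , m ∷ʳ w∷sub , h<w }
  where open Peel (peel y ys distinct)
... | no m≮y = record
  { run = run ; rest = y ∷ rest ; run⊆ = y ∷ʳ run⊆ ; rest⊆ = refl ∷ rest⊆
  ; run-increasing = run-increasing ; sizes = trans (+-suc (length run) (length rest)) (cong suc sizes)
  ; extend = extend′ }
  where
  open Peel (peel m ys (m∉ys ∷ AllPairs.tail distinct))
  y<m : y < m
  y<m = ≤∧≢⇒< (≮⇒≥ m≮y) (λ y≡m → m≢y (sym y≡m))
  skip-second : ∀ {zs} → zs ⊆ m ∷ ys → zs ⊆ m ∷ y ∷ ys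
  skip-second (_ ∷ʳ sub) = m ∷ʳ (y ∷ʳ sub)
  skip-second (eq ∷ sub) = eq ∷ (y ∷ʳ sub)
  extend′ : ∀ {h t} → h ∷ t ⊆ y ∷ rest → ∃ λ w → w ∷ h ∷ t ⊆ m ∷ y ∷ ys × h < w
  extend′ (_ ∷ʳ sub) = let (w , w∷sub , h<w) = extend sub in w , skip-second w∷sub , h<w
  extend′ (refl ∷ sub) = m , refl ∷ refl ∷ ⊆-trans sub rest⊆ , y<m

erdős-szekeres : ∀ a b (xs : List ℕ) → Unique xs → a * b < length xs →
  Chain _<_ (suc a) xs ⊎ Chain _>_ (suc b) xs
erdős-szekeres a zero (x ∷ xs) _ _ = inj₂ ([ x ] , refl ∷ Sublistₚ.[]⊆-universal xs , refl , [-])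
erdős-szekeres a (suc b) (x ∷ xs) distinct long with suc a ≤? length (x ∷ Peel.run (peel x xs distinct))
... | yes run-long = inj₁ (prefix-chain (suc a) (refl ∷ run⊆) run-increasing run-long)
  where open Peel (peel x xs distinct)
... | no run-short with erdős-szekeres a b rest (allPairs-⊆ rest⊆ (AllPairs.tail distinct)) rest-long
  where
  open Peel (peel x xs distinct)
  rest-long : a * b < length rest
  rest-long = +-cancelˡ-< a (a * b) (length rest) (begin-strict
    a + a * b                         ≡⟨ *-suc a b ⟨
    a * suc b                         <⟨ long ⟩
    suc (length xs)                   ≡⟨ cong suc sizes ⟨
    suc (length run) + length rest    ≤⟨ +-monoˡ-≤ (length rest) (≤-pred (≰⇒> run-short)) ⟩
    a + length rest                   ∎)
    where open ≤-Reasoning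
... | inj₁ (s , s⊆ , len , inc) = inj₁ (s , x ∷ʳ ⊆-trans s⊆ rest⊆ , len , inc)
  where open Peel (peel x xs distinct)
... | inj₂ (h ∷ t , s⊆ , len , dec) with Peel.extend (peel x xs distinct) s⊆
...   | w , w∷s⊆ , h<w = inj₂ (w ∷ h ∷ t , w∷s⊆ , cong suc len , h<w ∷ dec)

∈-range⁻ : ∀ {x n} → x ∈ range n → 1 ≤ x × x ≤ n
∈-range⁻ x∈ with ∈-applyUpTo⁻ suc x∈
... | _ , i<n , refl = s≤s z≤n , i<n

∈-range⁺ : ∀ {x n} → 1 ≤ x → x ≤ n → x ∈ range n
∈-range⁺ {suc x} _ x<n = ∈-applyUpTo⁺ suc x<n

range-unique : ∀ n → Unique (range n)
range-unique n = Uniqueₚ.applyUpTo⁺₁ suc n (λ i<j _ e → <⇒≢ i<j (suc-injective e))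

same-members-↭ : ∀ {xs ys : List A} → Unique xs → Unique ys →
  (∀ {x} → x ∈ xs → x ∈ ys) → (∀ {x} → x ∈ ys → x ∈ xs) → xs ↭ ys
same-members-↭ distinct-xs distinct-ys to from = ∼bag⇒↭ (unique∧set⇒bag distinct-xs distinct-ys (mk⇔ to from))

arrangement-unique : ∀ {σ n} → σ ↭ range n → Unique σ
arrangement-unique {n = n} σ↭ = Permₛ.Unique-resp-↭ (setoid ℕ) (↭⇒↭ₛ (↭-sym σ↭)) (range-unique n)

1≤n+2 : ∀ n → 1 ≤ n + 2
1≤n+2 n = ≤-trans (n≤1+n 1) (m≤n+m 2 n)

close-chain : ∀ {R n} (x : ℕ) (u w : List ℕ) {t} → t ⊆ w ++ u → length t ≡ n →
  Linked R (x ∷ t) ⊎ Linked R (t ++ [ x ]) → CycChain R (suc n) (u ++ x ∷ w)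
close-chain {R} x u w t⊆ len closed with sublist-++⁻ w u t⊆
... | tw , tu , tw⊆ , tu⊆ , refl =
  tu ++ x ∷ tw , Sublistₚ.++⁺ tu⊆ (refl ∷ tw⊆) ,
  trans (length-++-sucʳ tu x tw) (cong suc (trans (length-++-comm tu tw) len)) , cyclic closed
  where
  cyclic : Linked R (x ∷ tw ++ tu) ⊎ Linked R ((tw ++ tu) ++ [ x ]) → CycLinked R (tu ++ x ∷ tw)
  cyclic (inj₁ lin) = x ∷ tw ++ tu , swap-is-rotation tu (x ∷ tw) , lin
  cyclic (inj₂ lin) = (tw ++ tu) ++ [ x ] ,
    subst₂ IsRotation (++-assoc tu [ x ] tw) (sym (++-assoc tw tu [ x ]))
      (swap-is-rotation (tu ++ [ x ]) tw) ,
    lin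

upper-bound : ∀ a b → AlphaProperty (suc a) (suc b) (a * b + 2)
upper-bound a b σ σ↭ with ∈-∃++ (∈-resp-↭ (↭-sym σ↭) (∈-range⁺ {1} ≤-refl (1≤n+2 (a * b))))
... | u , w , refl = close (erdős-szekeres a b (w ++ u) (AllPairs.tail distinct) long)
  where
  rotated : 1 ∷ w ++ u ↭ range (a * b + 2)
  rotated = ↭-trans (↭-sym (↭-trans (shift 1 u w) (prep 1 (++-comm u w)))) σ↭
  distinct : Unique (1 ∷ w ++ u)
  distinct = arrangement-unique rotated
  size : length (w ++ u) ≡ suc (a * b)
  size = suc-injective
    (trans (↭-length rotated) (trans (length-applyUpTo suc (a * b + 2)) (+-comm (a * b) 2)))
  long : a * b < length (w ++ u)
  long = subst (a * b <_) (sym size) (n<1+n (a * b))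
  above-one : All (1 <_) (w ++ u)
  above-one = All.tabulate λ y∈ →
    ≤∧≢⇒< (proj₁ (∈-range⁻ (∈-resp-↭ rotated (there y∈)))) (All.lookup (AllPairs.head distinct) y∈)
  close : Chain _<_ (suc a) (w ++ u) ⊎ Chain _>_ (suc b) (w ++ u) →
    CycChain _<_ (suc (suc a)) (u ++ 1 ∷ w) ⊎ CycChain _>_ (suc (suc b)) (u ++ 1 ∷ w)
  close (inj₁ (t , t⊆ , len , inc)) =
    inj₁ (close-chain 1 u w t⊆ len (inj₁ (linked-cons (Sublistₚ.All-resp-⊆ t⊆ above-one) inc)))
  close (inj₂ (t , t⊆ , len , dec)) =
    inj₂ (close-chain 1 u w t⊆ len (inj₂ (linked-snoc (Sublistₚ.All-resp-⊆ t⊆ above-one) dec)))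

strict-run-length : ∀ (c : A → ℕ) {lo hi} {xs : List A} → AllPairs (λ x y → c x < c y) xs →
  All (λ x → lo ≤ c x) xs → All (λ x → c x < hi) xs → length xs ≤ hi ∸ lo
strict-run-length c [] _ _ = z≤n
strict-run-length c {lo} {hi} {x ∷ xs} (rises ∷ run) (lo≤ ∷ _) (<hi ∷ below) = begin
  suc (length xs)      ≤⟨ s≤s (strict-run-length c run rises below) ⟩
  suc (hi ∸ suc (c x)) ≡⟨ +-∸-assoc 1 <hi ⟨
  hi ∸ c x             ≤⟨ ∸-monoʳ-≤ hi lo≤ ⟩
  hi ∸ lo              ∎
  where open ≤-Reasoning

two-runs-length : ∀ (c : A → ℕ) M → (∀ x → c x < M) → {L₁ L₂ : List A} →
  AllPairs (λ x y → c x < c y) L₁ → AllPairs (λ x y → c x < c y) L₂ →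
  (∀ {x y} → x ∈ L₁ → y ∈ L₂ → c x ≤ c y) → length L₁ + length L₂ ≤ suc M
two-runs-length c M bounded {L₁} {[]} run₁ [] _ = begin
  length L₁ + 0 ≡⟨ +-identityʳ (length L₁) ⟩
  length L₁     ≤⟨ strict-run-length c run₁ (All.universal (λ _ → z≤n) L₁) (All.universal bounded L₁) ⟩
  M             ≤⟨ n≤1+n M ⟩
  suc M         ∎
  where open ≤-Reasoning
two-runs-length c M bounded {L₁} {y ∷ L₂} run₁ (rises ∷ run₂) weak = begin
  length L₁ + length (y ∷ L₂) ≤⟨ +-mono-≤ first second ⟩
  suc (c y) + (M ∸ c y)       ≡⟨ cong suc (m+[n∸m]≡n (<⇒≤ (bounded y))) ⟩
  suc M                       ∎
  where
  open ≤-Reasoning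
  first : length L₁ ≤ suc (c y)
  first = strict-run-length c run₁ (All.universal (λ _ → z≤n) L₁)
            (All.tabulate (λ x∈ → s≤s (weak x∈ (here refl))))
  second : length (y ∷ L₂) ≤ M ∸ c y
  second = strict-run-length c (rises ∷ run₂) (≤-refl ∷ All.map <⇒≤ rises) (All.universal bounded (y ∷ L₂))

-- The extremal arrangement of 1, …, ab+1: the entry 1 followed by the cells (i , v) of an
-- a × b grid listed column by column (v ascending), each column by ascending row i, where
-- cell (i , v) carries the value 2 + b·i + (b − 1 − v).
module Grid (a b : ℕ) where

  Cell : Set
  Cell = Fin a × Fin b

  row col : Cell → ℕ
  row (i , _) = toℕ i
  col (_ , v) = toℕ v

  value : Cell → ℕ
  value (i , v) = 2 + toℕ (combine i (opposite v))

  Before : Cell → Cell → Set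
  Before (i , v) (i′ , v′) = toℕ v < toℕ v′ ⊎ (v ≡ v′ × toℕ i < toℕ i′)

  cells : List Cell
  cells = concat (tabulate λ v → tabulate λ i → (i , v))

  cells-ordered : AllPairs Before cells
  cells-ordered = AllPairsₚ.concat⁺
    (Allₚ.tabulate⁺ λ _ → AllPairsₚ.tabulate⁺-< λ i<i′ → inj₂ (refl , i<i′))
    (AllPairsₚ.tabulate⁺-< λ v<v′ → Allₚ.tabulate⁺ λ _ → Allₚ.tabulate⁺ λ _ → inj₁ v<v′)

  ∈-cells : ∀ i v → (i , v) ∈ cells
  ∈-cells i v = ∈-concat⁺′ (∈-tabulate⁺ i) (∈-tabulate⁺ v)

  value-row : ∀ {p q} → row p < row q → value p < value q
  value-row {i , v} {i′ , v′} i<i′ = s≤s (s≤s (combine-monoˡ-< (opposite v) (opposite v′) i<i′))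

  value-col : ∀ i v v′ → value (i , v) < value (i , v′) → toℕ v′ < toℕ v
  value-col i v v′ lt = ≰⇒> λ v≤v′ → <⇒≱ opposite-< (opposite-antitone v≤v′)
    where
    opposite-< : toℕ (opposite v) < toℕ (opposite v′)
    opposite-< = +-cancelˡ-< (b * toℕ i) _ _
      (subst₂ _<_ (toℕ-combine i (opposite v)) (toℕ-combine i (opposite v′)) (≤-pred (≤-pred lt)))
    opposite-antitone : toℕ v ≤ toℕ v′ → toℕ (opposite v′) ≤ toℕ (opposite v)
    opposite-antitone v≤v′ =
      subst₂ _≤_ (sym (opposite-prop v′)) (sym (opposite-prop v)) (∸-monoʳ-≤ b (s≤s v≤v′))

  value-injective : ∀ {p q} → value p ≡ value q → p ≡ q
  value-injective {i , v} {i′ , v′} eq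
    with combine-injective i (opposite v) i′ (opposite v′) (toℕ-injective (suc-injective (suc-injective eq)))
  ... | refl , opposites = cong (i ,_) (begin
    v                     ≡⟨ opposite-involutive v ⟨
    opposite (opposite v) ≡⟨ cong opposite opposites ⟩
    opposite (opposite v′) ≡⟨ opposite-involutive v′ ⟩
    v′                    ∎)
    where open ≡-Reasoning

  rise-row : ∀ {p q} → Before p q → value p < value q → row p < row q
  rise-row (inj₂ (refl , i<i′)) _ = i<i′
  rise-row {i , v} {i′ , v′} (inj₁ v<v′) lt with <-cmp (toℕ i) (toℕ i′)
  ... | tri< i<i′ _ _ = i<i′
  ... | tri≈ _ i≡i′ _ with toℕ-injective i≡i′
  ...   | refl = contradiction (value-col i v v′ lt) (<⇒≯ v<v′)
  rise-row {i , v} {i′ , v′} (inj₁ v<v′) lt | tri> _ _ i′<i =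
    contradiction lt (<⇒≯ (value-row {i′ , v′} {i , v} i′<i))

  drop-col : ∀ {p q} → Before p q → value q < value p → col p < col q
  drop-col (inj₁ v<v′) _ = v<v′
  drop-col {p} {q} (inj₂ (refl , i<i′)) lt = contradiction lt (<⇒≯ (value-row {p} {q} i<i′))

  drop-row : ∀ {p q} → value q < value p → row q ≤ row p
  drop-row {p} {q} lt = ≮⇒≥ λ p<q → <-asym lt (value-row {p} {q} p<q)

  before-col : ∀ {p q} → Before p q → col p ≤ col q
  before-col (inj₁ v<v′) = <⇒≤ v<v′
  before-col (inj₂ (refl , _)) = ≤-refl

  before-≢ : ∀ {p q} → Before p q → value p ≢ value q
  before-≢ before eq with value-injective eq
  before-≢ (inj₁ v<v) _ | refl = <-irrefl refl v<v
  before-≢ (inj₂ (_ , i<i)) _ | refl = <-irrefl refl i<i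

  row<a : ∀ p → row p < a
  row<a (i , _) = toℕ<n i

  col<b : ∀ p → col p < b
  col<b (_ , v) = toℕ<n v

  rows-rise : ∀ {ps} → AllPairs Before ps → AllPairs (λ p q → value p < value q) ps →
    AllPairs (λ p q → row p < row q) ps
  rows-rise ordered increasing =
    AllPairs.zipWith (λ (before , lt) → rise-row before lt) (ordered , increasing)

  cols-rise : ∀ {ps} → AllPairs Before ps → AllPairs (λ p q → value q < value p) ps →
    AllPairs (λ p q → col p < col q) ps
  cols-rise ordered decreasing =
    AllPairs.zipWith (λ (before , lt) → drop-col before lt) (ordered , decreasing)

  increasing-bound : ∀ {t} → t ⊆ map value cells → Linked _<_ t → length t ≤ a
  increasing-bound t⊆ increasing with sublist-map⁻ value cells t⊆
  ... | ps , ps⊆ , refl = subst (_≤ a) (sym (length-map value ps)) (strict-run-length row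
    (rows-rise (allPairs-⊆ ps⊆ cells-ordered) (AllPairsₚ.map⁻ (Linkedₚ.Linked⇒AllPairs <-trans increasing)))
    (All.universal (λ _ → z≤n) ps) (All.universal row<a ps))

  decreasing-bound : ∀ {t} → t ⊆ map value cells → Linked _>_ t → length t ≤ b
  decreasing-bound t⊆ decreasing with sublist-map⁻ value cells t⊆
  ... | ps , ps⊆ , refl = subst (_≤ b) (sym (length-map value ps)) (strict-run-length col
    (cols-rise (allPairs-⊆ ps⊆ cells-ordered) (AllPairsₚ.map⁻ (Linkedₚ.Linked⇒AllPairs >-trans decreasing)))
    (All.universal (λ _ → z≤n) ps) (All.universal col<b ps))

  -- A cyclic increasing chain pu ++ pv among the cell values (pv ++ pu increasing) has at most
  -- a+1 entries: rows rise strictly within pv and within pu and never drop from pv to pu.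
  cyclic-increasing-bound : ∀ {s} → s ⊆ map value cells → CycLinked _<_ s → length s ≤ suc a
  cyclic-increasing-bound s⊆ (_ , rotation , increasing) with sublist-map⁻ value cells s⊆
  ... | ps , ps⊆ , refl with rotation-map value ps rotation
  ... | pu , pv , refl , refl
    with allPairs-++⁻ pu (allPairs-⊆ ps⊆ cells-ordered)
       | allPairs-++⁻ pv (AllPairsₚ.map⁻ (Linkedₚ.Linked⇒AllPairs <-trans increasing))
  ... | ordered-u , ordered-v , _ | increasing-v , increasing-u , rises =
    subst (_≤ suc a) (trans (sym (length-++ pv)) (trans (length-++-comm pv pu) (sym (length-map value (pu ++ pv)))))
      (two-runs-length row a row<a (rows-rise ordered-v increasing-v) (rows-rise ordered-u increasing-u)
        (λ x∈ y∈ → drop-row (rises x∈ y∈)))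

  -- A cyclic decreasing chain pu ++ pv among the cell values (pv ++ pu decreasing) has at most
  -- b+1 entries: columns rise strictly within pu and within pv and never drop from pu to pv.
  cyclic-decreasing-bound : ∀ {s} → s ⊆ map value cells → CycLinked _>_ s → length s ≤ suc b
  cyclic-decreasing-bound s⊆ (_ , rotation , decreasing) with sublist-map⁻ value cells s⊆
  ... | ps , ps⊆ , refl with rotation-map value ps rotation
  ... | pu , pv , refl , refl
    with allPairs-++⁻ pu (allPairs-⊆ ps⊆ cells-ordered)
       | allPairs-++⁻ pv (AllPairsₚ.map⁻ (Linkedₚ.Linked⇒AllPairs >-trans decreasing))
  ... | ordered-u , ordered-v , before | decreasing-v , decreasing-u , _ =
    subst (_≤ suc b) (trans (sym (length-++ pu)) (sym (length-map value (pu ++ pv))))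
      (two-runs-length col b col<b (cols-rise ordered-u decreasing-u) (cols-rise ordered-v decreasing-v)
        (λ x∈ y∈ → before-col (before x∈ y∈)))

  arrangement : List ℕ
  arrangement = 1 ∷ map value cells

  above-one : All (1 <_) (map value cells)
  above-one = Allₚ.map⁺ (All.universal (λ _ → s≤s (s≤s z≤n)) cells)

  -- No increasing cyclic chain of length a+2: one avoiding 1 lies among the cells (at most a+1
  -- entries); one through 1 starts at 1, the minimum, and continues linearly (at most 1+a).
  no-long-increasing : ∀ {s} → s ⊆ arrangement → length s ≡ suc (suc a) → CycLinked _<_ s → ⊥
  no-long-increasing (_ ∷ʳ s⊆) len cyclic =
    n≮n (suc a) (subst (_≤ suc a) len (cyclic-increasing-bound s⊆ cyclic))
  no-long-increasing (refl ∷ t⊆) len cyclic =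
    n≮n a (subst (_≤ a) (suc-injective len)
      (increasing-bound t⊆ (min-first-increasing (Sublistₚ.All-resp-⊆ t⊆ above-one) cyclic)))

  -- No decreasing cyclic chain of length b+2, symmetrically: through 1 it ends at 1.
  no-long-decreasing : ∀ {s} → s ⊆ arrangement → length s ≡ suc (suc b) → CycLinked _>_ s → ⊥
  no-long-decreasing (_ ∷ʳ s⊆) len cyclic =
    n≮n (suc b) (subst (_≤ suc b) len (cyclic-decreasing-bound s⊆ cyclic))
  no-long-decreasing (refl ∷ t⊆) len cyclic =
    n≮n b (subst (_≤ b) (suc-injective len)
      (decreasing-bound t⊆ (min-last-decreasing (Sublistₚ.All-resp-⊆ t⊆ above-one) cyclic)))

  arrangement-distinct : Unique arrangement
  arrangement-distinct = All.map <⇒≢ above-one ∷ AllPairsₚ.map⁺ (AllPairs.map before-≢ cells-ordered)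

  ∈-arrangement⁻ : ∀ {x} → x ∈ arrangement → 1 ≤ x
  ∈-arrangement⁻ (here refl) = s≤s z≤n
  ∈-arrangement⁻ (there x∈) with ∈-map⁻ value x∈
  ... | _ , _ , refl = s≤s z≤n

  ∈-arrangement⁺ : ∀ {x} → 1 ≤ x → x ≤ suc (a * b) → x ∈ arrangement
  ∈-arrangement⁺ {suc zero} _ _ = here refl
  ∈-arrangement⁺ {suc (suc k)} _ (s≤s k<ab) with combine-surjective {a} {b} (fromℕ< k<ab)
  ... | i , w , combined = there (subst (_∈ map value cells) is-k (∈-map⁺ value (∈-cells i (opposite w))))
    where
    is-k : value (i , opposite w) ≡ suc (suc k)
    is-k = trans (cong (λ c → 2 + toℕ c) (trans (cong (combine i) (opposite-involutive w)) combined))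
                 (cong (2 +_) (toℕ-fromℕ< k<ab))

  prefix : ℕ → List ℕ
  prefix m = filter (_≤? m) arrangement

  prefix-⊆ : ∀ m → prefix m ⊆ arrangement
  prefix-⊆ m = Sublistₚ.filter-⊆ (_≤? m) arrangement

  prefix-↭ : ∀ m → m ≤ suc (a * b) → prefix m ↭ range m
  prefix-↭ m m≤ = same-members-↭ (Uniqueₚ.filter⁺ (_≤? m) arrangement-distinct) (range-unique m) to from
    where
    to : ∀ {x} → x ∈ prefix m → x ∈ range m
    to x∈ with ∈-filter⁻ (_≤? m) x∈
    ... | x∈arrangement , x≤m = ∈-range⁺ (∈-arrangement⁻ x∈arrangement) x≤m
    from : ∀ {x} → x ∈ range m → x ∈ prefix m
    from x∈ with ∈-range⁻ x∈
    ... | 1≤x , x≤m = ∈-filter⁺ (_≤? m) (∈-arrangement⁺ 1≤x (≤-trans x≤m m≤)) x≤m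

  lower-bound : ∀ m → m ≤ suc (a * b) → ¬ AlphaProperty (suc a) (suc b) m
  lower-bound m m≤ property with property (prefix m) (prefix-↭ m m≤)
  ... | inj₁ (s , s⊆ , len , cyclic) = no-long-increasing (⊆-trans s⊆ (prefix-⊆ m)) len cyclic
  ... | inj₂ (s , s⊆ , len , cyclic) = no-long-decreasing (⊆-trans s⊆ (prefix-⊆ m)) len cyclic

theorem1 : ∀ (k ℓ : ℕ) → 1 ≤ k → 1 ≤ ℓ → IsAlpha k ℓ ((k ∸ 1) * (ℓ ∸ 1) + 2)
theorem1 (suc a) (suc b) _ _ =
  1≤n+2 (a * b) ,
  upper-bound a b ,
  λ m _ m<n → Grid.lower-bound a b m (≤-pred (subst (suc m ≤_) (+-comm (a * b) 2) m<n))
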